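{- Under the standing assumptions below, for every $p\in P$, the set $S_p$ is an antichain of $P$.
   Context: Standing assumptions: $L$ is a distributive Fomin lattice with minimum element $\hat{0}$: a modular, locally finite lattice with finitely many upper and lower covers at each element, value set $V$, differential degree $r$, and weighting $w$ on coverings satisfying $\sum_{y\lessdot x}w(y\lessdot x)+r=\sum_{x\lessdot z}w(x\lessdot z)$ for all $x$, with $w$ projective-constant. Then $L$ is the lattice of finite order ideals of the poset $P$ of its join-irreducibles (points), and there is $w:P\to V$ with $w(x\lessdot y)=w(y\setminus x)$. $P$ is unique-cover-modular: whenever two distinct elements of $P$ both cover a common element or are both covered by a common element, there is a unique element covered by both and a unique element covering both. The weighting is positive on points: $V=\mathbb{Z}$ and $w(p)>0$ for all $p\in P$. For $p\in P$, $C_p^-$ is the set of elements covered by $p$, $C_p^+$ the set of elements covering $p$, and $S_p=\{x\in P: x\neq p,\ \exists a\in C_p^-, b\in C_p^+,\ a<x<b\}$. -}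

module Defs where

open import Data.Integer using (ℤ; _+_; +_)
open import Data.List using (List; foldr; map)
open import Data.List.Membership.Propositional using (_∈_; _∉_)
open import Data.List.Relation.Unary.Unique.Propositional using (Unique)
open import Data.Product using (Σ; _×_; Σ-syntax)
open import Data.Empty using (⊥)
open import Function.Bundles using (_⇔_)
open import Relation.Binary.PropositionalEquality using (_≡_; _≢_)
open import Relation.Binary.Structures using (IsPartialOrder)

sumℤ : List ℤ → ℤ
sumℤ = foldr _+_ (+ 0)

Enumerates : {A : Set} → List A → (A → Set) → Set
Enumerates {A} xs Q = Unique xs × (∀ a → (a ∈ xs) ⇔ Q a)

-- Notions relative to a poset (P , ≤) of points (join-irreducibles of L).
module PosetNotions {P : Set} (_≤_ : P → P → Set) where

  _<_ : P → P → Set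
  x < y = x ≤ y × x ≢ y

  _⋖_ : P → P → Set
  x ⋖ y = x < y × (∀ z → x < z → z < y → ⊥)

  IsFiniteIdeal : List P → Set
  IsFiniteIdeal I = Unique I × (∀ p q → q ≤ p → p ∈ I → q ∈ I)

  -- p is a maximal element of I: removing p gives a lower cover of I in L
  MaxIn : List P → P → Set
  MaxIn I p = p ∈ I × (∀ q → q ∈ I → p ≤ q → q ≡ p)

  -- p is a minimal element of P ∖ I: adding p gives an upper cover of I in L
  MinOutside : List P → P → Set
  MinOutside I p = p ∉ I × (∀ q → q < p → q ∈ I)

  -- principal down-sets are finite (points of L are finite ideals, L locally finite)
  FinitePrincipalIdeals : Set
  FinitePrincipalIdeals = ∀ p → Σ[ D ∈ List P ] Enumerates D (λ q → q ≤ p)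

  -- weighted differential condition on L = J_fin(P), with w(x ⋖ y) = w(y ∖ x):
  -- for every finite ideal I, its lower covers and upper covers are finite
  -- in number and  Σ_{lower covers} w + r = Σ_{upper covers} w.
  DifferentialCondition : (P → ℤ) → ℤ → Set
  DifferentialCondition w r =
    ∀ I → IsFiniteIdeal I →
      Σ[ Dn ∈ List P ] Σ[ Up ∈ List P ]
        Enumerates Dn (MaxIn I) × Enumerates Up (MinOutside I) ×
        (sumℤ (map w Dn) + r ≡ sumℤ (map w Up))

  UniqueCommonLower : P → P → Set
  UniqueCommonLower a b = Σ[ c ∈ P ] (c ⋖ a × c ⋖ b × (∀ c' → c' ⋖ a → c' ⋖ b → c' ≡ c))

  UniqueCommonUpper : P → P → Set
  UniqueCommonUpper a b = Σ[ d ∈ P ] (a ⋖ d × b ⋖ d × (∀ d' → a ⋖ d' → b ⋖ d' → d' ≡ d))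

  UniqueCoverModular : Set
  UniqueCoverModular =
    ∀ a b → a ≢ b →
      ((Σ[ c ∈ P ] (c ⋖ a × c ⋖ b)) → UniqueCommonLower a b × UniqueCommonUpper a b) ×
      ((Σ[ d ∈ P ] (a ⋖ d × b ⋖ d)) → UniqueCommonLower a b × UniqueCommonUpper a b)

  S : P → P → Set
  S p x = x ≢ p × Σ[ a ∈ P ] Σ[ b ∈ P ] (a ⋖ p × p ⋖ b × a < x × x < b)

  IsAntichain : (P → Set) → Set
  IsAntichain A = ∀ x y → A x → A y → x ≤ y → x ≡ y

-- Suppose x < y in S_p, witnessed by a ⋖ p ⋖ b with a < x < y < b. Take a lower
-- cover y₁ of b above y. Then p ≠ y₁ share the upper cover b, so they have a common
-- lower cover c ⋖ p; c ≠ a because a < x < y₁ forbids a ⋖ y₁. Hence a and c share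
-- the upper cover p and have a common lower cover e. Now e ⋖ c ⋖ y₁ and e < a < x < y₁
-- is the same configuration below y₁ < b, so induction on the size of the principal
-- ideal of b excludes it.
module Submission where

open import Defs
open import Data.Integer using (ℤ; _<_; +_)
open import Relation.Binary.PropositionalEquality using (_≡_)
open import Relation.Binary.Structures using (IsPartialOrder)

open import Data.Nat as ℕ using (ℕ; _∸_)
open import Data.Nat.Properties using (∸-monoʳ-<; <⇒≤)
open import Data.Nat.Induction using (<-wellFounded)
open import Data.Fin as Fin using (Fin)
open import Data.Fin.Properties using (injective⇒≤)
open import Data.List using (List; _∷_; length; lookup)
open import Data.List.Relation.Unary.Any using (here; there; index)
open import Data.List.Relation.Unary.All as All using ()
open import Data.List.Membership.Propositional using (_∈_; _∉_)
open import Data.List.Membership.Propositional.Properties using (∈-lookup)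
open import Data.List.Membership.Setoid.Properties using (index-injective)
open import Data.List.Relation.Binary.Subset.Propositional using (_⊆_)
open import Data.List.Relation.Unary.Unique.Propositional using (Unique; _∷_)
open import Data.Product using (_×_; _,_; proj₁; proj₂; ∃-syntax)
open import Data.Empty using (⊥; ⊥-elim)
open import Function.Bundles using (Equivalence)
open import Induction.WellFounded using (Acc; acc)
open import Relation.Nullary using (¬_; Dec; yes; no)
open import Relation.Nullary.Decidable using (decidable-stable)
open import Relation.Binary.PropositionalEquality
  using (_≢_; refl; sym; trans; cong; subst; setoid)

module _ {A : Set} where

  Unique-≟ : ∀ {xs : List A} {x y} → Unique xs → x ∈ xs → y ∈ xs → Dec (x ≡ y)
  Unique-≟ _ (here x≡z) (here y≡z) = yes (trans x≡z (sym y≡z))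
  Unique-≟ (z∉ ∷ _) (here x≡z) (there y∈) =
    no λ x≡y → All.lookup z∉ (subst (_∈ _) (trans (sym x≡y) x≡z) y∈) refl
  Unique-≟ (z∉ ∷ _) (there x∈) (here y≡z) =
    no λ x≡y → All.lookup z∉ (subst (_∈ _) (trans x≡y y≡z) x∈) refl
  Unique-≟ (_ ∷ u) (there x∈) (there y∈) = Unique-≟ u x∈ y∈

  lookup-injective : ∀ {xs : List A} → Unique xs → ∀ i j → lookup xs i ≡ lookup xs j → i ≡ j
  lookup-injective (_ ∷ _) Fin.zero Fin.zero _ = refl
  lookup-injective (z∉ ∷ _) Fin.zero (Fin.suc j) eq = ⊥-elim (All.lookup z∉ (∈-lookup j) eq)
  lookup-injective (z∉ ∷ _) (Fin.suc i) Fin.zero eq = ⊥-elim (All.lookup z∉ (∈-lookup i) (sym eq))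
  lookup-injective (_ ∷ u) (Fin.suc i) (Fin.suc j) eq = cong Fin.suc (lookup-injective u i j eq)

  Unique-⊂-length-< : ∀ {xs ys : List A} {z} →
    Unique xs → xs ⊆ ys → z ∈ ys → z ∉ xs → length xs ℕ.< length ys
  Unique-⊂-length-< {xs} {ys} {z} u xs⊆ys z∈ys z∉xs = injective⇒≤ f-injective
    where
    f : Fin (ℕ.suc (length xs)) → Fin (length ys)
    f Fin.zero    = index z∈ys
    f (Fin.suc i) = index (xs⊆ys (∈-lookup i))

    same-entry : ∀ i j → f (Fin.suc i) ≡ f (Fin.suc j) → lookup xs i ≡ lookup xs j
    same-entry i j = index-injective (setoid A) (xs⊆ys (∈-lookup i)) (xs⊆ys (∈-lookup j))

    z≡entry : ∀ i → f Fin.zero ≡ f (Fin.suc i) → z ≡ lookup xs i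
    z≡entry i = index-injective (setoid A) z∈ys (xs⊆ys (∈-lookup i))

    f-injective : ∀ {i j} → f i ≡ f j → i ≡ j
    f-injective {Fin.zero}  {Fin.zero}  _  = refl
    f-injective {Fin.zero}  {Fin.suc j} eq = ⊥-elim (z∉xs (subst (_∈ xs) (sym (z≡entry j eq)) (∈-lookup j)))
    f-injective {Fin.suc i} {Fin.zero}  eq = ⊥-elim (z∉xs (subst (_∈ xs) (sym (z≡entry i (sym eq))) (∈-lookup i)))
    f-injective {Fin.suc i} {Fin.suc j} eq = cong Fin.suc (lookup-injective u i j (same-entry i j eq))

module FiniteIdeals {P : Set} {_≤_ : P → P → Set} (isPO : IsPartialOrder _≡_ _≤_)
  (finite : PosetNotions.FinitePrincipalIdeals _≤_) where

  open PosetNotions _≤_ renaming (_<_ to _⊏_)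
  open IsPartialOrder isPO using (antisym) renaming (refl to ≤-refl; trans to ≤-trans)

  ⊏-≤-trans : ∀ {x y z} → x ⊏ y → y ≤ z → x ⊏ z
  ⊏-≤-trans (x≤y , x≢y) y≤z =
    ≤-trans x≤y y≤z , λ { refl → x≢y (antisym x≤y y≤z) }

  ideal : P → List P
  ideal b = proj₁ (finite b)

  ideal-unique : ∀ b → Unique (ideal b)
  ideal-unique b = proj₁ (proj₂ (finite b))

  ∈-ideal : ∀ {x b} → x ≤ b → x ∈ ideal b
  ∈-ideal {x} {b} = Equivalence.from (proj₂ (proj₂ (finite b)) x)

  ∈-ideal⁻ : ∀ {x b} → x ∈ ideal b → x ≤ b
  ∈-ideal⁻ {x} {b} = Equivalence.to (proj₂ (proj₂ (finite b)) x)

  rank : P → ℕ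
  rank b = length (ideal b)

  rank-mono-< : ∀ {x y} → x ⊏ y → rank x ℕ.< rank y
  rank-mono-< {x} {y} (x≤y , x≢y) =
    Unique-⊂-length-< (ideal-unique x) (λ z∈ → ∈-ideal (≤-trans (∈-ideal⁻ z∈) x≤y))
      (∈-ideal ≤-refl) (λ y∈ → x≢y (antisym x≤y (∈-ideal⁻ y∈)))

  -- Only ¬¬ constructively: y is itself covered by b unless some y < z < b exists,
  -- and then recursion on rank b ∸ rank y finds a lower cover of b above z.
  ¬¬-lower-cover-above : ∀ {y b} → y ⊏ b → ¬ ¬ (∃[ c ] (y ≤ c × c ⋖ b))
  ¬¬-lower-cover-above {y} {b} y⊏b = go y⊏b (<-wellFounded (rank b ∸ rank y))
    where
    go : ∀ {y} → y ⊏ b → Acc ℕ._<_ (rank b ∸ rank y) → ¬ ¬ (∃[ c ] (y ≤ c × c ⋖ b))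
    go {y} y⊏b (acc rec) no-cover = no-cover (y , ≤-refl , y⊏b , between)
      where
      between : ∀ z → y ⊏ z → z ⊏ b → ⊥
      between z y⊏z z⊏b =
        go z⊏b (rec (∸-monoʳ-< (rank-mono-< y⊏z) (<⇒≤ (rank-mono-< z⊏b))))
          λ (c , z≤c , c⋖b) → no-cover (c , ≤-trans (proj₁ y⊏z) z≤c , c⋖b)

  module _ (common-lower-cover : ∀ {a c d} → a ≢ c → a ⋖ d → c ⋖ d → ∃[ e ] (e ⋖ a × e ⋖ c))
    where

    no-3-chain-over-2-covers : ∀ {a p b x y} → a ⋖ p → p ⋖ b → a ⊏ x → x ⊏ y → y ⊏ b → ⊥
    no-3-chain-over-2-covers {b = b} a⋖p p⋖b a⊏x x⊏y y⊏b =
      go (<-wellFounded (rank b)) a⋖p p⋖b a⊏x x⊏y y⊏b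
      where
      go : ∀ {a p b x y} → Acc ℕ._<_ (rank b) → a ⋖ p → p ⋖ b → a ⊏ x → x ⊏ y → y ⊏ b → ⊥
      go {a} {p} {b} {x} {y} (acc rec) a⋖p p⋖b a⊏x x⊏y y⊏b =
        ¬¬-lower-cover-above y⊏b λ (y₁ , y≤y₁ , y₁⋖b) → descend y₁ (⊏-≤-trans x⊏y y≤y₁) y₁⋖b
        where
        descend : ∀ y₁ → x ⊏ y₁ → y₁ ⋖ b → ⊥
        descend y₁ x⊏y₁ y₁⋖b
          with c , c⋖p , c⋖y₁ ← common-lower-cover (λ { refl → proj₂ a⋖p x a⊏x x⊏y₁ }) p⋖b y₁⋖b
          with e , e⋖a , e⋖c ← common-lower-cover (λ { refl → proj₂ c⋖y₁ x a⊏x x⊏y₁ }) a⋖p c⋖p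
          = go (rec (rank-mono-< (proj₁ y₁⋖b))) e⋖c c⋖y₁ (proj₁ e⋖a) a⊏x x⊏y₁

module _ {P : Set} {_≤_ : P → P → Set} where

  open PosetNotions _≤_

  UniqueCoverModular⇒common-lower-cover : UniqueCoverModular →
    ∀ {a c d} → a ≢ c → a ⋖ d → c ⋖ d → ∃[ e ] (e ⋖ a × e ⋖ c)
  UniqueCoverModular⇒common-lower-cover ucm {a} {c} {d} a≢c a⋖d c⋖d
    with e , e⋖a , e⋖c , _ ← proj₁ (proj₂ (ucm a c a≢c) (d , a⋖d , c⋖d))
    = e , e⋖a , e⋖c

lemma5p26 : (P : Set) (_≤_ : P → P → Set) → IsPartialOrder _≡_ _≤_ →
    PosetNotions.FinitePrincipalIdeals _≤_ →
    (w : P → ℤ) → (∀ p → + 0 < w p) → (r : ℤ) →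
    PosetNotions.DifferentialCondition _≤_ w r →
    PosetNotions.UniqueCoverModular _≤_ →
    ∀ p → PosetNotions.IsAntichain _≤_ (PosetNotions.S _≤_ p)
lemma5p26 P _≤_ isPO finite _ _ _ _ ucm p x y
  (_ , a , _ , a⋖p , _ , a⊏x , _) (_ , _ , b , _ , p⋖b , _ , y⊏b) x≤y =
  decidable-stable (Unique-≟ (ideal-unique y) (∈-ideal x≤y) (∈-ideal ≤-refl))
    λ x≢y → no-3-chain-over-2-covers (UniqueCoverModular⇒common-lower-cover ucm)
              a⋖p p⋖b a⊏x (x≤y , x≢y) y⊏b
  where
  open FiniteIdeals isPO finite
  open IsPartialOrder isPO using () renaming (refl to ≤-refl)
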